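{- Let $\underline{x}=(x_j)_{j\in\mathbb{Z}}\in(\mathbb{N}^*)^{\mathbb{Z}}$ satisfy $m(\underline{x})=3$, and let $w=w_1w_2w_3\cdots$ be the infinite word with $w_i=x_{i-1}$ (i.e. $w=\pi(\underline{x})=x_0x_1x_2\cdots$). Then every odd cut of $w$ is good.
   Context: For $\underline{x}\in(\mathbb{N}^*)^{\mathbb{Z}}$, $\lambda(\underline{x})=[x_0;x_1,\dots]+[0;x_{ -1},x_{ -2},\dots]$, $\sigma$ is the shift $(\sigma\underline{x})_i=x_{i-1}$, and $m(\underline{x})=\sup_{n\in\mathbb{Z}}\lambda(\sigma^n\underline{x})$. For an infinite word $w=w_1w_2\cdots$ of positive integers and $i\ge1$, the cut at position $i$ is $w_1\cdots w_{i-1}\,\vert\, w_iw_{i+1}\cdots$, with value $[w_i;w_{i+1},\dots]+[0;w_{i-1},\dots,w_1]$ (the second term being $0$ if $i=1$). The cut is bad if its value is $>3$ and good otherwise; it is an odd cut if $i$ is odd. -}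

module Defs where

open import Data.Nat as ℕ using (ℕ; suc; _∸_)
open import Data.Integer as ℤ using (ℤ; +_)
open import Data.Rational as ℚ using (ℚ; 0ℚ; _≤_; _<_; _+_; _-_; 1/_; ≢-nonZero)
open import Data.List using (List; []; _∷_; map; upTo; reverse)
open import Data.Product using (Σ; ∃; _×_)
open import Relation.Nullary using (yes; no)

⟦_⟧ : ℕ → ℚ
⟦ n ⟧ = (+ n) ℚ./ 1

-- total reciprocal (1/0 := 0; never used at 0 for positive partial quotients)
inv : ℚ → ℚ
inv q with q ℚ.≟ 0ℚ
... | yes _ = 0ℚ
... | no ne = 1/_ q {{≢-nonZero ne}}

-- zcf [a₁, …, aₙ] = [0; a₁, …, aₙ]   (zcf [] = 0)
zcf : List ℕ → ℚ
zcf []      = 0ℚ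
zcf (a ∷ l) = inv (⟦ a ⟧ + zcf l)

-- k-th convergent [0; b 0, …, b (k-1)] of the infinite continued fraction [0; b 0, b 1, …]
conv0 : (ℕ → ℕ) → ℕ → ℚ
conv0 b k = zcf (map b (upTo k))

-- comparisons of the limit of a (convergent) rational sequence with a rational
LimLe : (ℕ → ℚ) → ℚ → Set
LimLe s c = ∀ ε → 0ℚ < ε → ∃ λ K → ∀ k → K ℕ.≤ k → s k ≤ c + ε

LimGe : (ℕ → ℚ) → ℚ → Set
LimGe s c = ∀ ε → 0ℚ < ε → ∃ λ K → ∀ k → K ℕ.≤ k → c - ε ≤ s k

-- shift: (σ x)_i = x_{i-1}, hence (σⁿ x)_i = x_{i-n}
shiftBy : ℤ → (ℤ → ℕ) → (ℤ → ℕ)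
shiftBy n x i = x (i ℤ.- n)

-- convergent sequence of λ(x) = [x₀; x₁, …] + [0; x₋₁, x₋₂, …]
lamSeq : (ℤ → ℕ) → ℕ → ℚ
lamSeq x k = ⟦ x (+ 0) ⟧ + conv0 (λ j → x (+ suc j)) k + conv0 (λ j → x (ℤ.-[1+ j ])) k

-- m(x) = 3 : sup over n ∈ ℤ of λ(σⁿ x) equals 3
MEqualsThree : (ℤ → ℕ) → Set
MEqualsThree x =
  (∀ n → LimLe (lamSeq (shiftBy n x)) ⟦ 3 ⟧) ×
  (∀ ε → 0ℚ < ε → ∃ λ n → LimGe (lamSeq (shiftBy n x)) (⟦ 3 ⟧ - ε))

-- the word π(x) = x₀ x₁ x₂ …, indexed from 1: w_i = x_{i-1} (w 0 is unused)
π : (ℤ → ℕ) → ℕ → ℕ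
π x i = x (+ (i ∸ 1))

-- convergent sequence of the cut value at position i ≥ 1:
-- [w_i; w_{i+1}, …] + [0; w_{i-1}, …, w_1]
cutSeq : (ℕ → ℕ) → ℕ → ℕ → ℚ
cutSeq w i k = ⟦ w i ⟧ + conv0 (λ j → w (suc (i ℕ.+ j))) k
               + zcf (reverse (map (λ j → w (suc j)) (upTo (i ∸ 1))))

GoodCut : (ℕ → ℕ) → ℕ → Set
GoodCut w i = LimLe (cutSeq w i) ⟦ 3 ⟧

module Submission where

open import Defs
open import Data.Nat using (ℕ; suc; _*_; _<_)
open import Data.Integer using (ℤ)

open import Data.Nat as ℕ using (zero; _+_; _∸_; _⊔_)
import Data.Nat.Properties as ℕP
open import Data.Integer as ℤ using (+_; +[1+_]; -[1+_])
import Data.Integer.Properties as ℤP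
open import Data.Rational as ℚ using (ℚ; mkℚ; 0ℚ; 1/_; *≤*; *<*; ≢-nonZero)
import Data.Rational.Properties as ℚP
open import Data.List using (List; []; _∷_; _++_; map; upTo; reverse; applyUpTo; applyDownFrom)
import Data.List.Properties as LP
open import Data.Product using (_,_)
open import Relation.Binary.PropositionalEquality
open import Relation.Nullary using (yes; no)
open import Data.Empty using (⊥-elim)

-- The value of the cut at position 2t+1 of π x is λ(σ^{-2t} x) with the backward
-- continued fraction [0; x_{-1}, x_{-2}, …] of the shifted sequence truncated after
-- 2t partial quotients. Even convergents of a continued fraction lie below its value,
-- so the cut value is at most λ(σ^{-2t} x) ≤ m(x) = 3.

inv-≢0 : ∀ p (p≢0 : p ≢ 0ℚ) → inv p ≡ 1/_ p {{≢-nonZero p≢0}}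
inv-≢0 p p≢0 with p ℚ.≟ 0ℚ
... | yes p≡0 = ⊥-elim (p≢0 p≡0)
... | no _    = refl

inv-antimono-≤ : ∀ {p q} → 0ℚ ℚ.< p → p ℚ.≤ q → inv q ℚ.≤ inv p
inv-antimono-≤ {p@(mkℚ +[1+ n ] dp _)} {q@(mkℚ +[1+ m ] dq _)} _ (*≤* p≤q)
  rewrite inv-≢0 p (λ ()) | inv-≢0 q (λ ()) =
  *≤* (subst₂ ℤ._≤_ (ℤP.*-comm +[1+ n ] +[1+ dq ]) (ℤP.*-comm +[1+ m ] +[1+ dp ]) p≤q)
inv-antimono-≤ {mkℚ (+ 0) _ _}       (*<* (ℤ.+<+ ()))
inv-antimono-≤ {mkℚ -[1+ _ ] _ _}    (*<* ())
inv-antimono-≤ {mkℚ +[1+ _ ] _ _} {mkℚ (+ 0) _ _}    _ (*≤* (ℤ.+≤+ ()))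
inv-antimono-≤ {mkℚ +[1+ _ ] _ _} {mkℚ -[1+ _ ] _ _} _ (*≤* ())

inv-nonNeg : ∀ {q} → 0ℚ ℚ.≤ q → 0ℚ ℚ.≤ inv q
inv-nonNeg {q} 0≤q with q ℚ.≟ 0ℚ
... | yes _   = ℚP.≤-refl
... | no q≢0  = 1/-nonNeg q q≢0 0≤q
  where
  1/-nonNeg : ∀ q (q≢0 : q ≢ 0ℚ) → 0ℚ ℚ.≤ q → 0ℚ ℚ.≤ 1/_ q {{≢-nonZero q≢0}}
  1/-nonNeg (mkℚ +[1+ _ ] _ _) _ _ = *≤* (ℤ.+≤+ ℕ.z≤n)
  1/-nonNeg (mkℚ (+ 0) _ _) q≢0 _ with ℕ.NonZero.nonZero (≢-nonZero q≢0)
  ... | ()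
  1/-nonNeg (mkℚ -[1+ _ ] _ _) _ (*≤* ())

⟦⟧-nonNeg : ∀ a → 0ℚ ℚ.≤ ⟦ a ⟧
⟦⟧-nonNeg a = ℚP.nonNegative⁻¹ _ {{ℚP.normalize-nonNeg a 1}}

⟦⟧-pos : ∀ {a} → 0 < a → 0ℚ ℚ.< ⟦ a ⟧
⟦⟧-pos {suc a} _ = ℚP.positive⁻¹ _ {{ℚP.normalize-pos (suc a) 1}}

zcf-nonNeg : ∀ l → 0ℚ ℚ.≤ zcf l
zcf-nonNeg []      = ℚP.≤-refl
zcf-nonNeg (a ∷ l) = inv-nonNeg (ℚP.+-mono-≤ (⟦⟧-nonNeg a) (zcf-nonNeg l))

zcf-∷-antimono : ∀ {a} l l′ → 0 < a → zcf l ℚ.≤ zcf l′ → zcf (a ∷ l′) ℚ.≤ zcf (a ∷ l)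
zcf-∷-antimono {a} l _ 0<a l≤l′ =
  inv-antimono-≤ (ℚP.+-mono-<-≤ (⟦⟧-pos 0<a) (zcf-nonNeg l)) (ℚP.+-monoʳ-≤ ⟦ a ⟧ l≤l′)

data EvenPositive : List ℕ → Set where
  []   : EvenPositive []
  pair : ∀ {a b l} → 0 < a → 0 < b → EvenPositive l → EvenPositive (a ∷ b ∷ l)

zcf-even-prefix-≤ : ∀ {L} M → EvenPositive L → zcf L ℚ.≤ zcf (L ++ M)
zcf-even-prefix-≤ M [] = zcf-nonNeg M
zcf-even-prefix-≤ {a ∷ b ∷ L} M (pair 0<a 0<b even) =
  zcf-∷-antimono (b ∷ L ++ M) (b ∷ L) 0<a
    (zcf-∷-antimono L (L ++ M) 0<b (zcf-even-prefix-≤ M even))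

applyUpTo-evenPositive : ∀ t (f : ℕ → ℕ) → (∀ j → 0 < f j) → EvenPositive (applyUpTo f (2 * t))
applyUpTo-evenPositive zero    f f>0 = []
applyUpTo-evenPositive (suc t) f f>0 rewrite ℕP.+-suc t (t + 0) =
  pair (f>0 0) (f>0 1) (applyUpTo-evenPositive t (λ j → f (2 + j)) (λ j → f>0 (2 + j)))

applyUpTo-+ : ∀ (f : ℕ → ℕ) m n → applyUpTo f (m + n) ≡ applyUpTo f m ++ applyUpTo (λ j → f (m + j)) n
applyUpTo-+ f zero    n = refl
applyUpTo-+ f (suc m) n = cong (f 0 ∷_) (applyUpTo-+ (λ j → f (suc j)) m n)

applyDownFrom-reindex : ∀ n (f g : ℕ → ℕ) → (∀ j → j < n → g j ≡ f (n ∸ suc j)) →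
                        applyDownFrom f n ≡ applyUpTo g n
applyDownFrom-reindex zero    f g g≡f = refl
applyDownFrom-reindex (suc n) f g g≡f =
  cong₂ _∷_ (sym (g≡f 0 ℕ.z<s))
            (applyDownFrom-reindex n f (λ j → g (suc j)) (λ j j<n → g≡f (suc j) (ℕ.s<s j<n)))

LimLe-eventually-≤ : ∀ {s s′ : ℕ → ℚ} {c} N → (∀ k → N ℕ.≤ k → s k ℚ.≤ s′ k) →
                     LimLe s′ c → LimLe s c
LimLe-eventually-≤ N s≤s′ s′≤c ε ε>0 with s′≤c ε ε>0
... | K , bound = K ⊔ N , λ k K⊔N≤k →
  ℚP.≤-trans (s≤s′ k (ℕP.≤-trans (ℕP.m≤n⊔m K N) K⊔N≤k))
             (bound k (ℕP.≤-trans (ℕP.m≤m⊔n K N) K⊔N≤k))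

module _ (x : ℤ → ℕ) (m : ℕ) where

  private
    y : ℤ → ℕ
    y = shiftBy (ℤ.- + m) x

    y≡x : ∀ i → y i ≡ x (i ℤ.+ + m)
    y≡x i = cong (λ n → x (i ℤ.+ n)) (ℤP.neg-involutive (+ m))

  π-forward : ∀ k → ⟦ π x (suc m) ⟧ ℚ.+ conv0 (λ j → π x (suc (suc m + j))) k
                  ≡ ⟦ y (+ 0) ⟧ ℚ.+ conv0 (λ j → y (+ suc j)) k
  π-forward k = cong₂ (λ a l → ⟦ a ⟧ ℚ.+ zcf l)
    (sym (trans (y≡x (+ 0)) (cong x (ℤP.+-identityˡ (+ m)))))
    (LP.map-cong (λ j → sym (trans (y≡x (+ suc j)) (cong (λ n → x (+ suc n)) (ℕP.+-comm j m))))
                 (upTo k))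

  π-backward : reverse (map (λ j → π x (suc j)) (upTo m)) ≡ applyUpTo (λ j → y -[1+ j ]) m
  π-backward = begin
    reverse (map (λ j → π x (suc j)) (upTo m))  ≡⟨ cong reverse (LP.map-upTo _ m) ⟩
    reverse (applyUpTo (λ j → x (+ j)) m)       ≡⟨ LP.reverse-applyUpTo _ m ⟩
    applyDownFrom (λ j → x (+ j)) m             ≡⟨ applyDownFrom-reindex m _ _ y≡x[m-1-j] ⟩
    applyUpTo (λ j → y -[1+ j ]) m              ∎
    where
    open ≡-Reasoning
    y≡x[m-1-j] : ∀ j → j < m → y -[1+ j ] ≡ x (+ (m ∸ suc j))
    y≡x[m-1-j] j j<m = trans (y≡x -[1+ j ]) (cong x (ℤP.⊖-≥ j<m))

  cutSeq-≤-lamSeq : (∀ j → 0 < x j) → ∀ t → m ≡ 2 * t → ∀ k → m ℕ.≤ k →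
                    cutSeq (π x) (suc m) k ℚ.≤ lamSeq y k
  cutSeq-≤-lamSeq x>0 t refl k m≤k = ℚP.+-mono-≤ (ℚP.≤-reflexive (π-forward k)) backward≤
    where
    B : ℕ → ℕ
    B j = y -[1+ j ]

    upTo-k-split : map B (upTo k) ≡ applyUpTo B m ++ applyUpTo (λ j → B (m + j)) (k ∸ m)
    upTo-k-split = trans (LP.map-upTo B k)
      (trans (cong (applyUpTo B) (sym (ℕP.m+[n∸m]≡n m≤k))) (applyUpTo-+ B m (k ∸ m)))

    backward≤ : zcf (reverse (map (λ j → π x (suc j)) (upTo m))) ℚ.≤ conv0 B k
    backward≤ = subst₂ ℚ._≤_ (cong zcf (sym π-backward)) (cong zcf (sym upTo-k-split))
                  (zcf-even-prefix-≤ _ (applyUpTo-evenPositive t B (λ j → x>0 _)))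

proposition2p3 : (x : ℤ → ℕ) → (∀ j → 0 < x j) → MEqualsThree x →
                 ∀ t → GoodCut (π x) (suc (2 * t))
proposition2p3 x x>0 (λ≤3 , _) t =
  LimLe-eventually-≤ {c = ⟦ 3 ⟧} (2 * t)
    (cutSeq-≤-lamSeq x (2 * t) x>0 t refl)
    (λ≤3 (ℤ.- + (2 * t)))
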